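{- Each of the logics $\mathsf{SM}$, $\mathsf{LQM}$, $\mathsf{UQM}$, $\mathsf{DP}$, $\mathsf{AP}$, $\mathsf{WS}$ is complete with respect to the class of SMAs, LQMAs, UQMAs, DPLs, APLs, WSAs respectively. That is, for all formulas $A,B$ of $\mathcal{L}$: if $A\le B$ holds under every valuation in every algebra of the corresponding class, then the sequent $A\vdash B$ is derivable in the corresponding logic.
   Context: The language $\mathcal{L}$ over a denumerable set of propositional variables is $A ::= p \mid \top \mid \bot \mid \neg A \mid A\wedge A \mid A\vee A$. Semi De Morgan logic $\mathsf{SM}$ is the set of sequents $A\vdash B$ derivable from the axiom schemes $\bot\vdash A$, $A\vdash\top$, $\neg\top\vdash\bot$, $\top\vdash\neg\bot$, $A\vdash A$, $A\wedge B\vdash A$, $A\wedge B\vdash B$, $A\vdash A\vee B$, $B\vdash A\vee B$, $\neg A\vdash\neg\neg\neg A$, $\neg\neg\neg A\vdash\neg A$, $\neg A\wedge\neg B\vdash\neg(A\vee B)$, $\neg\neg A\wedge\neg\neg B\vdash\neg\neg(A\wedge B)$, $A\wedge(B\vee C)\vdash(A\wedge B)\vee(A\wedge C)$, using the rules: from $A\vdash B$ and $B\vdash C$ infer $A\vdash C$; from $A\vdash B$ and $A\vdash C$ infer $A\vdash B\wedge C$; from $A\vdash B$ and $C\vdash B$ infer $A\vee C\vdash B$; from $A\vdash B$ infer $\neg B\vdash\neg A$. The extensions are obtained by adding one axiom scheme: $\mathsf{LQM}$: $A\vdash\neg\neg A$; $\mathsf{UQM}$: $\neg\neg A\vdash A$;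 $\mathsf{DP}$: $\neg A\wedge\neg\neg A\vdash\bot$; $\mathsf{AP}$: $A\wedge\neg A\vdash\bot$; $\mathsf{WS}$: $\top\vdash\neg A\vee\neg\neg A$. A semi De Morgan algebra (SMA) is an algebra $(L,\wedge,\vee,{}',\top,\bot)$ such that $(L,\wedge,\vee,\top,\bot)$ is a bounded distributive lattice and for all $a,b$: $\bot'=\top$, $\top'=\bot$, $(a\vee b)'=a'\wedge b'$, $(a\wedge b)''=a''\wedge b''$, $a'=a'''$. An LQMA is an SMA with $a\le a''$ for all $a$; a UQMA is an SMA with $a''\le a$; a DPL is an SMA with $a'\wedge a''=\bot$; an APL is an SMA with $a\wedge a'=\bot$; a WSA is an SMA with $a'\vee a''=\top$. Formulas are interpreted under valuations of the variables into $L$, with $\neg$ interpreted as ${}'$ and the other connectives as the lattice operations and bounds. -}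

module Defs where

open import Level using (Level; suc; _⊔_)
open import Data.Nat using (ℕ)
open import Relation.Binary.Core using (Rel)
open import Relation.Binary.Structures using (IsEquivalence)
open import Algebra.Core using (Op₁; Op₂)
open import Algebra.Definitions using (Congruent₁)
open import Algebra.Lattice.Structures using (IsDistributiveLattice)

infixr 7 _∧'_
infixr 6 _∨'_

data Fm : Set where
  var  : ℕ → Fm
  ⊤'   : Fm
  ⊥'   : Fm
  ¬'_  : Fm → Fm
  _∧'_ : Fm → Fm → Fm
  _∨'_ : Fm → Fm → Fm

data Logic : Set where
  SM LQM UQM DP AP WS : Logic

data Extra : Logic → Fm → Fm → Set where
  lqm : ∀ {A} → Extra LQM A (¬' ¬' A)
  uqm : ∀ {A} → Extra UQM (¬' ¬' A) A
  dp  : ∀ {A} → Extra DP ((¬' A) ∧' (¬' ¬' A)) ⊥'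
  ap  : ∀ {A} → Extra AP (A ∧' (¬' A)) ⊥'
  ws  : ∀ {A} → Extra WS ⊤' ((¬' A) ∨' (¬' ¬' A))

infix 4 _⊢_⦂_
data _⊢_⦂_ (L : Logic) : Fm → Fm → Set where
  ax-⊥      : ∀ {A} → L ⊢ ⊥' ⦂ A
  ax-⊤      : ∀ {A} → L ⊢ A ⦂ ⊤'
  ax-¬⊤     : L ⊢ ¬' ⊤' ⦂ ⊥'
  ax-¬⊥     : L ⊢ ⊤' ⦂ ¬' ⊥'
  ax-id     : ∀ {A} → L ⊢ A ⦂ A
  ax-∧₁     : ∀ {A B} → L ⊢ A ∧' B ⦂ A
  ax-∧₂     : ∀ {A B} → L ⊢ A ∧' B ⦂ B
  ax-∨₁     : ∀ {A B} → L ⊢ A ⦂ A ∨' B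
  ax-∨₂     : ∀ {A B} → L ⊢ B ⦂ A ∨' B
  ax-¬³₁    : ∀ {A} → L ⊢ ¬' A ⦂ ¬' ¬' ¬' A
  ax-¬³₂    : ∀ {A} → L ⊢ ¬' ¬' ¬' A ⦂ ¬' A
  ax-¬∨     : ∀ {A B} → L ⊢ (¬' A) ∧' (¬' B) ⦂ ¬' (A ∨' B)
  ax-¬¬∧    : ∀ {A B} → L ⊢ (¬' ¬' A) ∧' (¬' ¬' B) ⦂ ¬' ¬' (A ∧' B)
  ax-dist   : ∀ {A B C} → L ⊢ A ∧' (B ∨' C) ⦂ (A ∧' B) ∨' (A ∧' C)
  ax-extra  : ∀ {A B} → Extra L A B → L ⊢ A ⦂ B
  r-cut     : ∀ {A B C} → L ⊢ A ⦂ B → L ⊢ B ⦂ C → L ⊢ A ⦂ C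
  r-∧       : ∀ {A B C} → L ⊢ A ⦂ B → L ⊢ A ⦂ C → L ⊢ A ⦂ B ∧' C
  r-∨       : ∀ {A B C} → L ⊢ A ⦂ B → L ⊢ C ⦂ B → L ⊢ A ∨' C ⦂ B
  r-contra  : ∀ {A B} → L ⊢ A ⦂ B → L ⊢ ¬' B ⦂ ¬' A

record SMA (c ℓ : Level) : Set (suc (c ⊔ ℓ)) where
  infixr 7 _∧_
  infixr 6 _∨_
  field
    Carrier : Set c
    _≈_     : Rel Carrier ℓ
    _∨_     : Op₂ Carrier
    _∧_     : Op₂ Carrier
    _′      : Op₁ Carrier
    ⊤ ⊥     : Carrier
    isDistributiveLattice : IsDistributiveLattice _≈_ _∨_ _∧_
    ⊥-least    : ∀ a → (⊥ ∨ a) ≈ a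
    ⊤-greatest : ∀ a → (⊤ ∧ a) ≈ a
    ′-cong     : Congruent₁ _≈_ _′
    ⊥′         : (⊥ ′) ≈ ⊤
    ⊤′         : (⊤ ′) ≈ ⊥
    ∨′         : ∀ a b → ((a ∨ b) ′) ≈ ((a ′) ∧ (b ′))
    ∧′′        : ∀ a b → (((a ∧ b) ′) ′) ≈ (((a ′) ′) ∧ ((b ′) ′))
    ′′′        : ∀ a → (a ′) ≈ (((a ′) ′) ′)

  _≤_ : Carrier → Carrier → Set ℓ
  a ≤ b = (a ∧ b) ≈ a

  ⟦_⟧ : Fm → (ℕ → Carrier) → Carrier
  ⟦ var n ⟧  v = v n
  ⟦ ⊤' ⟧     v = ⊤
  ⟦ ⊥' ⟧     v = ⊥
  ⟦ ¬' A ⟧   v = (⟦ A ⟧ v) ′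
  ⟦ A ∧' B ⟧ v = ⟦ A ⟧ v ∧ ⟦ B ⟧ v
  ⟦ A ∨' B ⟧ v = ⟦ A ⟧ v ∨ ⟦ B ⟧ v

InClass : ∀ {c ℓ} → Logic → SMA c ℓ → Set (c ⊔ ℓ)
InClass SM  S = Level.Lift _ Data.Unit.⊤ where import Data.Unit
InClass LQM S = ∀ a → a ≤ ((a ′) ′)             where open SMA S
InClass UQM S = ∀ a → ((a ′) ′) ≤ a             where open SMA S
InClass DP  S = ∀ a → ((a ′) ∧ ((a ′) ′)) ≈ ⊥   where open SMA S
InClass AP  S = ∀ a → (a ∧ (a ′)) ≈ ⊥           where open SMA S
InClass WS  S = ∀ a → ((a ′) ∨ ((a ′) ′)) ≈ ⊤   where open SMA S

Valid : Logic → Fm → Fm → Set₁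
Valid L A B = (S : SMA Level.zero Level.zero) → InClass L S →
              (v : ℕ → SMA.Carrier S) → SMA._≤_ S (SMA.⟦_⟧ S A v) (SMA.⟦_⟧ S B v)

module Submission where

-- Completeness by the Lindenbaum–Tarski construction.
--
-- Formulas, with equality taken to be interderivability
-- (A ≋ B iff L ⊢ A ⦂ B and L ⊢ B ⦂ A), form a semi De Morgan algebra: the
-- lattice laws are derivable from the ∧/∨ axioms and rules, ¬ respects ≋
-- by contraposition, and the SMA identities for ′ are (halves of) axioms.
-- In this Lindenbaum algebra the lattice order is derivability, and the
-- extra axiom of L says exactly that the algebra lies in the class of L.
-- Finally, under the canonical valuation p ↦ p every formula denotes
-- itself.  So if A ≤ B is valid in the class of L, it holds in particular
-- in the Lindenbaum algebra of L under the canonical valuation, i.e.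
-- A ∧ B ≋ A, whence L ⊢ A ⦂ A ∧' B ⦂ B.

open import Defs
open import Level using (lift)
open import Data.Unit using (tt)
open import Data.Product using (_×_; _,_; proj₂)
open import Relation.Binary.PropositionalEquality using (_≡_; refl; cong; cong₂; subst₂)
open import Relation.Binary.Structures using (IsEquivalence)
open import Algebra.Lattice.Structures using (IsDistributiveLattice)

module Lindenbaum (L : Logic) where

  ∧-mono : ∀ {A B C D} → L ⊢ A ⦂ B → L ⊢ C ⦂ D → L ⊢ A ∧' C ⦂ B ∧' D
  ∧-mono p q = r-∧ (r-cut ax-∧₁ p) (r-cut ax-∧₂ q)

  ∨-mono : ∀ {A B C D} → L ⊢ A ⦂ B → L ⊢ C ⦂ D → L ⊢ A ∨' C ⦂ B ∨' D
  ∨-mono p q = r-∨ (r-cut p ax-∨₁) (r-cut q ax-∨₂)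

  ∧-swap : ∀ {A B} → L ⊢ A ∧' B ⦂ B ∧' A
  ∧-swap = r-∧ ax-∧₂ ax-∧₁

  ∨-swap : ∀ {A B} → L ⊢ A ∨' B ⦂ B ∨' A
  ∨-swap = r-∨ ax-∨₂ ax-∨₁

  ∧-assocʳ : ∀ {A B C} → L ⊢ (A ∧' B) ∧' C ⦂ A ∧' (B ∧' C)
  ∧-assocʳ = r-∧ (r-cut ax-∧₁ ax-∧₁) (∧-mono ax-∧₂ ax-id)

  ∧-assocˡ : ∀ {A B C} → L ⊢ A ∧' (B ∧' C) ⦂ (A ∧' B) ∧' C
  ∧-assocˡ = r-∧ (∧-mono ax-id ax-∧₁) (r-cut ax-∧₂ ax-∧₂)

  ∨-assocʳ : ∀ {A B C} → L ⊢ (A ∨' B) ∨' C ⦂ A ∨' (B ∨' C)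
  ∨-assocʳ = r-∨ (∨-mono ax-id ax-∨₁) (r-cut ax-∨₂ ax-∨₂)

  ∨-assocˡ : ∀ {A B C} → L ⊢ A ∨' (B ∨' C) ⦂ (A ∨' B) ∨' C
  ∨-assocˡ = r-∨ (r-cut ax-∨₁ ax-∨₁) (∨-mono ax-∨₂ ax-id)

  ∧-distrib-∨-back : ∀ {A B C} → L ⊢ (A ∧' B) ∨' (A ∧' C) ⦂ A ∧' (B ∨' C)
  ∧-distrib-∨-back = r-∨ (∧-mono ax-id ax-∨₁) (∧-mono ax-id ax-∨₂)

  ∨-distrib-∧ : ∀ {A B C} → L ⊢ A ∨' (B ∧' C) ⦂ (A ∨' B) ∧' (A ∨' C)
  ∨-distrib-∧ = r-∨ (r-∧ ax-∨₁ ax-∨₁) (∧-mono ax-∨₂ ax-∨₂)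

  -- The hard direction, by distributing twice with the axiom:
  -- (A ∨ B) ∧ (A ∨ C) ⊢ ((A ∨ B) ∧ A) ∨ ((A ∨ B) ∧ C) ⊢ A ∨ (B ∧ C).
  ∨-distrib-∧-back : ∀ {A B C} → L ⊢ (A ∨' B) ∧' (A ∨' C) ⦂ A ∨' (B ∧' C)
  ∨-distrib-∧-back = r-cut ax-dist (r-∨ (r-cut ax-∧₂ ax-∨₁) second-disjunct)
    where
    -- (A ∨ B) ∧ C ⊢ (C ∧ A) ∨ (C ∧ B) ⊢ A ∨ (B ∧ C)
    second-disjunct : ∀ {A B C} → L ⊢ (A ∨' B) ∧' C ⦂ A ∨' (B ∧' C)
    second-disjunct = r-cut ∧-swap
      (r-cut ax-dist (r-∨ (r-cut ax-∧₂ ax-∨₁) (r-cut ∧-swap ax-∨₂)))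

  infix 4 _≋_
  _≋_ : Fm → Fm → Set
  A ≋ B = (L ⊢ A ⦂ B) × (L ⊢ B ⦂ A)

  ≋-isEquivalence : IsEquivalence _≋_
  ≋-isEquivalence = record
    { refl  = ax-id , ax-id
    ; sym   = λ (p , q) → q , p
    ; trans = λ (p , q) (p′ , q′) → r-cut p p′ , r-cut q′ q
    }

  isDistributiveLattice : IsDistributiveLattice _≋_ _∨'_ _∧'_
  isDistributiveLattice = record
    { isLattice = record
      { isEquivalence = ≋-isEquivalence
      ; ∨-comm     = λ _ _ → ∨-swap , ∨-swap
      ; ∨-assoc    = λ _ _ _ → ∨-assocʳ , ∨-assocˡ
      ; ∨-cong     = λ (p , q) (p′ , q′) → ∨-mono p p′ , ∨-mono q q′
      ; ∧-comm     = λ _ _ → ∧-swap , ∧-swap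
      ; ∧-assoc    = λ _ _ _ → ∧-assocʳ , ∧-assocˡ
      ; ∧-cong     = λ (p , q) (p′ , q′) → ∧-mono p p′ , ∧-mono q q′
      ; absorptive = (λ _ _ → r-∨ ax-id ax-∧₁ , ax-∨₁)
                   , (λ _ _ → ax-∧₁ , r-∧ ax-id ax-∨₁)
      }
    ; ∨-distrib-∧ = (λ _ _ _ → ∨-distrib-∧ , ∨-distrib-∧-back)
                  , (λ _ _ _ → r-cut ∨-swap (r-cut ∨-distrib-∧ (∧-mono ∨-swap ∨-swap))
                             , r-cut (∧-mono ∨-swap ∨-swap) (r-cut ∨-distrib-∧-back ∨-swap))
    ; ∧-distrib-∨ = (λ _ _ _ → ax-dist , ∧-distrib-∨-back)
                  , (λ _ _ _ → r-cut ∧-swap (r-cut ax-dist (∨-mono ∧-swap ∧-swap))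
                             , r-cut (∨-mono ∧-swap ∧-swap) (r-cut ∧-distrib-∨-back ∧-swap))
    }

  -- The Lindenbaum algebra of L: each SMA identity for ′ is one of the
  -- negation axioms together with its converse, obtained by contraposition.
  algebra : SMA Level.zero Level.zero
  algebra = record
    { Carrier    = Fm
    ; _≈_        = _≋_
    ; _∨_        = _∨'_
    ; _∧_        = _∧'_
    ; _′         = ¬'_
    ; ⊤          = ⊤'
    ; ⊥          = ⊥'
    ; isDistributiveLattice = isDistributiveLattice
    ; ⊥-least    = λ _ → r-∨ ax-⊥ ax-id , ax-∨₂
    ; ⊤-greatest = λ _ → ax-∧₂ , r-∧ ax-⊤ ax-id
    ; ′-cong     = λ (p , q) → r-contra q , r-contra p
    ; ⊥′         = ax-⊤ , ax-¬⊥
    ; ⊤′         = ax-¬⊤ , ax-⊥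
    ; ∨′         = λ _ _ → r-∧ (r-contra ax-∨₁) (r-contra ax-∨₂) , ax-¬∨
    ; ∧′′        = λ _ _ → r-∧ (r-contra (r-contra ax-∧₁)) (r-contra (r-contra ax-∧₂))
                         , ax-¬¬∧
    ; ′′′        = λ _ → ax-¬³₁ , ax-¬³₂
    }

  open SMA algebra using (_≤_; ⟦_⟧)

  derivable⇒≤ : ∀ {A B} → L ⊢ A ⦂ B → A ≤ B
  derivable⇒≤ p = ax-∧₁ , r-∧ ax-id p

  ≤⇒derivable : ∀ {A B} → A ≤ B → L ⊢ A ⦂ B
  ≤⇒derivable (_ , A⊢A∧B) = r-cut A⊢A∧B ax-∧₂

  ⟦⟧-canonical : ∀ A → ⟦ A ⟧ var ≡ A
  ⟦⟧-canonical (var n)  = refl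
  ⟦⟧-canonical ⊤'       = refl
  ⟦⟧-canonical ⊥'       = refl
  ⟦⟧-canonical (¬' A)   = cong ¬'_ (⟦⟧-canonical A)
  ⟦⟧-canonical (A ∧' B) = cong₂ _∧'_ (⟦⟧-canonical A) (⟦⟧-canonical B)
  ⟦⟧-canonical (A ∨' B) = cong₂ _∨'_ (⟦⟧-canonical A) (⟦⟧-canonical B)

lindenbaum-inClass : (L : Logic) → InClass L (Lindenbaum.algebra L)
lindenbaum-inClass SM  = lift tt
lindenbaum-inClass LQM = λ _ → Lindenbaum.derivable⇒≤ LQM (ax-extra lqm)
lindenbaum-inClass UQM = λ _ → Lindenbaum.derivable⇒≤ UQM (ax-extra uqm)
lindenbaum-inClass DP  = λ _ → ax-extra dp , ax-⊥
lindenbaum-inClass AP  = λ _ → ax-extra ap , ax-⊥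
lindenbaum-inClass WS  = λ _ → ax-⊤ , ax-extra ws

theorem2p5 : (L : Logic) (A B : Fm) → Valid L A B → L ⊢ A ⦂ B
theorem2p5 L A B valid = ≤⇒derivable (subst₂ _≤_ (⟦⟧-canonical A) (⟦⟧-canonical B) canonical)
  where
  open Lindenbaum L
  open SMA algebra using (_≤_; ⟦_⟧)

  canonical : ⟦ A ⟧ var ≤ ⟦ B ⟧ var
  canonical = valid algebra (lindenbaum-inClass L) var
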